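{- Let $(W,S)$ be a simply-laced triangle-free Coxeter system and let ${\boldsymbol{\alpha}}$ be a link of rank $r\ge2$. Let $1\le i\le r-1$ and suppose $\operatorname{supp}_{\llbracket 2i\rrbracket}([{\boldsymbol{\alpha}}])=\{s,t\}$ and $\operatorname{supp}_{\llbracket 2i+2\rrbracket}([{\boldsymbol{\alpha}}])=\{t,u\}$ with $m(s,t)=3=m(t,u)$. Then $\operatorname{supp}_{\llbracket 2i+1\rrbracket}([{\boldsymbol{\alpha}}])=\{s,t,u\}$, ${\boldsymbol{\alpha}}_{\llbracket 2i\rrbracket}\ne{\boldsymbol{\alpha}}_{\llbracket 2i+2\rrbracket}$, and ${\boldsymbol{\alpha}}_{\llbracket 2i+1\rrbracket}\in\{s,t,u\}\setminus\{{\boldsymbol{\alpha}}_{\llbracket 2i\rrbracket},{\boldsymbol{\alpha}}_{\llbracket 2i+2\rrbracket}\}$.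
   Context: A Coxeter system $(W,S)$: finite $S$, $W=\langle S\mid (st)^{m(s,t)}=e\rangle$, $m(s,s)=1$, $m(s,t)\in\{2,3,\dots,\infty\}$ for $s\ne t$; simply laced: $m(s,t)\le3$; Coxeter graph $\Gamma$ on $S$ with edge $\{s,t\}$ iff $m(s,t)\ge3$; triangle free: no three-cycles in $\Gamma$. Reduced expression: minimal-length word for its element. Braid move: replace consecutive $sts$ by $tst$ with $m(s,t)=3$; braid class $[{\boldsymbol{\alpha}}]$: reduced expressions reachable from ${\boldsymbol{\alpha}}$ by braid moves. For ${\boldsymbol{\alpha}}=s_{x_1}\cdots s_{x_m}$, ${\boldsymbol{\alpha}}_{\llbracket k\rrbracket}=s_{x_k}$ is the letter in position $k$, and $\operatorname{supp}_{\llbracket k\rrbracket}([{\boldsymbol{\alpha}}])$ is the set of letters appearing in position $k$ of some element of $[{\boldsymbol{\alpha}}]$. $\llbracket i,i+2\rrbracket$ is a braid shadow of ${\boldsymbol{\alpha}}$ if $s_{x_i}=s_{x_{i+2}}$ and $m(s_{x_i},s_{x_{i+1}})=3$; $\operatorname{bs}([{\boldsymbol{\alpha}}])$ is the set of braid shadows of all elements of $[{\boldsymbol{\alpha}}]$ and $\operatorname{rank}({\boldsymbol{\alpha}})=|\operatorname{bs}([{\boldsymbol{\alpha}}])|$. A reduced expression with $m\ge1$ letters is a link if $m=1$ or $m$ is odd and $\operatorname{bs}([{\boldsymbol{\alpha}}])=\{\llbracket1,3\rrbracket,\dots,\llbracket m-2,m\rrbracket\}$; a link of rank $r$ has $2r+1$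 letters. -}

module Defs where

open import Data.Nat using (ℕ; zero; suc; _+_; _*_; _≤_; _<_; _∸_)
open import Data.Nat.Properties using ()
open import Data.Fin using (Fin)
open import Data.List using (List; []; _∷_; _++_; length)
open import Data.Maybe using (Maybe; just; nothing)
open import Data.Product using (Σ; _×_; _,_; ∃; ∃-syntax)
open import Data.Sum using (_⊎_)
open import Relation.Binary.PropositionalEquality using (_≡_; _≢_)
open import Relation.Binary.Construct.Closure.ReflexiveTransitive using (Star)
open import Relation.Nullary using (¬_)
open import Function.Bundles using (_⇔_)

Odd : ℕ → Set
Odd n = ∃[ k ] n ≡ suc (2 * k)

data ℕ∞ : Set where
  fin : ℕ → ℕ∞
  ∞   : ℕ∞

data _≤∞_ : ℕ∞ → ℕ → Set where
  fin≤ : ∀ {a k} → a ≤ k → fin a ≤∞ k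

data _≥∞_ : ℕ∞ → ℕ → Set where
  fin≥ : ∀ {a k} → k ≤ a → fin a ≥∞ k
  ∞≥   : ∀ {k} → ∞ ≥∞ k

record CoxeterMatrix (n : ℕ) : Set where
  field
    m      : Fin n → Fin n → ℕ∞
    m-diag : ∀ s → m s s ≡ fin 1
    m-sym  : ∀ s t → m s t ≡ m t s
    m-off  : ∀ s t → s ≢ t → m s t ≥∞ 2

module _ {n : ℕ} (M : CoxeterMatrix n) where
  open CoxeterMatrix M

  Word : Set
  Word = List (Fin n)

  alt : Fin n → Fin n → ℕ → Word
  alt s t zero    = []
  alt s t (suc k) = s ∷ alt t s k

  stPow : Fin n → Fin n → ℕ → Word
  stPow s t zero    = []
  stPow s t (suc k) = s ∷ t ∷ stPow s t k

  -- Equality of words in W = ⟨ S | (st)^{m(s,t)} = e ⟩ (m finite):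
  -- the congruence on the free monoid generated by the defining relations
  -- (each generator is an involution, so the monoid presentation gives the group).
  data _≈W_ : Word → Word → Set where
    rel   : ∀ s t k → m s t ≡ fin k → stPow s t k ≈W []
    cong  : ∀ p q {a b} → a ≈W b → (p ++ a ++ q) ≈W (p ++ b ++ q)
    refl≈ : ∀ {a} → a ≈W a
    sym≈  : ∀ {a b} → a ≈W b → b ≈W a
    trans≈ : ∀ {a b c} → a ≈W b → b ≈W c → a ≈W c

  Reduced : Word → Set
  Reduced α = ∀ β → β ≈W α → length α ≤ length β

  data BraidMove : Word → Word → Set where
    braid : ∀ p q s t → m s t ≡ fin 3 →
            BraidMove (p ++ s ∷ t ∷ s ∷ q) (p ++ t ∷ s ∷ t ∷ q)

  InBraidClass : Word → Word → Set
  InBraidClass α β = Star BraidMove α β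

  -- letter at (1-indexed) position k
  at : Word → ℕ → Maybe (Fin n)
  at []      _             = nothing
  at (x ∷ w) zero          = nothing
  at (x ∷ w) (suc zero)    = just x
  at (x ∷ w) (suc (suc k)) = at w (suc k)

  Supp : ℕ → Word → Fin n → Set
  Supp k α x = ∃[ β ] (InBraidClass α β × at β k ≡ just x)

  BraidShadow : Word → ℕ → Set
  BraidShadow β i = ∃[ a ] ∃[ b ]
    (at β i ≡ just a × at β (suc i) ≡ just b × at β (suc (suc i)) ≡ just a × m a b ≡ fin 3)

  InBS : Word → ℕ → Set
  InBS α i = ∃[ β ] (InBraidClass α β × BraidShadow β i)

  IsLink : Word → Set
  IsLink α = Reduced α × 1 ≤ length α ×
    (length α ≡ 1 ⊎
      (Odd (length α) ×
       (∀ i → InBS α i ⇔ (Odd i × 1 ≤ i × i + 2 ≤ length α))))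

  SimplyLaced : Set
  SimplyLaced = ∀ s t → m s t ≤∞ 3

  TriangleFree : Set
  TriangleFree = ∀ a b c → a ≢ b → b ≢ c → a ≢ c →
    ¬ (m a b ≥∞ 3 × m b c ≥∞ 3 × m a c ≥∞ 3)

{-# OPTIONS --safe #-}
-- Write K = 2i.  Braid shadows of a link start only at odd positions, so no braid move is
-- centred at K+1; any other move either fixes the letter at K+1 or swaps it with the letter
-- at K or at K+2, and both swapped letters lie in supp⟦K⟧ ∪ supp⟦K+2⟧ = {s,t,u}.  Hence the
-- letter at K+1 stays in {s,t,u} along the whole braid class.  Conversely the shadows
-- ⟦K-1,K+1⟧ and ⟦K+1,K+3⟧ bring both letters of {s,t} and both letters of {t,u} to K+1.
-- Adjacent letters of a reduced word differ, and α_K = α_{K+2} would make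
-- α_K α_{K+1} α_K a braid shadow at the even position K.
module Submission where

open import Defs
open import Data.Nat using (ℕ; zero; suc; _+_; _*_; _≤_; _<_; _∸_; z≤n; s≤s)
open import Data.Nat.Properties
  using (+-identityʳ; +-suc; +-comm; *-suc; *-monoʳ-≤; 1+n≰n; n≤1+n; ≤-trans; +-cancelˡ-≤;
         m≤n⇒m≤1+n; m+n≤o⇒n≤o; <-≤-connex; m≤n⇒∃[o]m+o≡n; module ≤-Reasoning)
open import Data.Nat.Divisibility using (_∣_; ∣1⇒≡1; ∣m+n∣m⇒∣n; m∣m*n)
open import Data.Fin using (Fin)
open import Data.List using ([]; _∷_; _++_; length)
open import Data.List.Properties using (length-++)
open import Data.Maybe using (Maybe; just)
open import Data.Maybe.Relation.Unary.Any using (Any; just; drop-just)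
open import Data.Product using (_×_; ∃-syntax; _,_; proj₁; proj₂)
open import Data.Sum using (_⊎_; inj₁; inj₂)
import Data.Sum as Sum
open import Data.Empty using (⊥-elim)
open import Level using (0ℓ)
open import Relation.Nullary using (¬_)
open import Relation.Unary using (Pred; _⊆_)
open import Relation.Binary.PropositionalEquality
  using (_≡_; _≢_; refl; sym; trans; subst; subst₂; ≢-sym)
import Relation.Binary.PropositionalEquality as ≡
open import Relation.Binary.Construct.Closure.ReflexiveTransitive using (Star; ε; _◅_; _◅◅_)
open import Function using (_∘_)
open import Function.Bundles using (_⇔_; mk⇔; Equivalence)
open import Function.Construct.Identity using (⇔-id)
open import Function.Construct.Composition using (_⇔-∘_)

¬Odd-2* : ∀ i → ¬ Odd (2 * i)
¬Odd-2* i (j , 2i≡1+2j) = 2≢1 (∣1⇒≡1 (∣m+n∣m⇒∣n 2∣2j+1 (m∣m*n j)))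
  where
    2≢1 : 2 ≢ 1
    2≢1 ()
    2∣2j+1 : 2 ∣ 2 * j + 1
    2∣2j+1 = subst (2 ∣_) (trans 2i≡1+2j (+-comm 1 (2 * j))) (m∣m*n i)

<-or-offset : ∀ k n → k < n ⊎ ∃[ d ] d + n ≡ k
<-or-offset k n with <-≤-connex k n
... | inj₁ k<n = inj₁ k<n
... | inj₂ n≤k with m≤n⇒∃[o]m+o≡n n≤k
...   | d , n+d≡k = inj₂ (d , trans (+-comm d n) n+d≡k)

pair-cover : ∀ {a} {A : Set a} {p} {P : Pred A p} {x y a b : A} → x ≢ y →
  (x ≡ a ⊎ x ≡ b) → (y ≡ a ⊎ y ≡ b) → P x → P y → P a × P b
pair-cover x≢y (inj₁ refl) (inj₁ refl) _ _ = ⊥-elim (x≢y refl)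
pair-cover x≢y (inj₁ refl) (inj₂ refl) Px Py = Px , Py
pair-cover x≢y (inj₂ refl) (inj₁ refl) Px Py = Py , Px
pair-cover x≢y (inj₂ refl) (inj₂ refl) _ _ = ⊥-elim (x≢y refl)

⇔⇒⊆ : ∀ {a p q} {A : Set a} {P : Pred A p} {Q : Pred A q} → (∀ x → P x ⇔ Q x) → P ⊆ Q
⇔⇒⊆ P⇔Q = Equivalence.to (P⇔Q _)

Any-cong : ∀ {a p} {A : Set a} {P : Pred A p} {m m' : Maybe A} → m ≡ m' → Any P m ⇔ Any P m'
Any-cong {P = P} e = mk⇔ (subst (Any P) e) (subst (Any P) (sym e))

Any-just : ∀ {a p} {A : Set a} {P : Pred A p} {m : Maybe A} {x} → m ≡ just x → P x → Any P m
Any-just refl Px = just Px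

module _ {n : ℕ} (M : CoxeterMatrix n) where
  open CoxeterMatrix M

  at-++ˡ : ∀ (p l l' : Word M) k → suc k ≤ length p → at M (p ++ l) (suc k) ≡ at M (p ++ l') (suc k)
  at-++ˡ (_ ∷ p) l l' zero    _       = refl
  at-++ˡ (_ ∷ p) l l' (suc k) (s≤s k<p) = at-++ˡ p l l' k k<p

  at-++ʳ : ∀ (p l : Word M) d → at M (p ++ l) (suc (d + length p)) ≡ at M l (suc d)
  at-++ʳ []      l d rewrite +-identityʳ d = refl
  at-++ʳ (_ ∷ p) l d rewrite +-suc d (length p) = at-++ʳ p l d

  at-defined : ∀ (w : Word M) j → suc j ≤ length w → ∃[ a ] at M w (suc j) ≡ just a
  at-defined (a ∷ w) zero    _         = a , refl
  at-defined (_ ∷ w) (suc j) (s≤s j<w) = at-defined w j j<w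

  adjacent-site : ∀ (w : Word M) j {a b} → at M w (suc j) ≡ just a → at M w (suc (suc j)) ≡ just b →
    ∃[ p ] ∃[ q ] w ≡ p ++ a ∷ b ∷ q
  adjacent-site (a ∷ b ∷ q) zero    refl refl = [] , q , refl
  adjacent-site (_ ∷ [])    zero    refl ()
  adjacent-site (c ∷ w)     (suc j) ea   eb with adjacent-site w j ea eb
  ... | p , q , refl = c ∷ p , q , refl

  braidShadow-site : ∀ (w : Word M) k → BraidShadow M w k →
    ∃[ p ] ∃[ q ] ∃[ x ] ∃[ y ] (m x y ≡ fin 3 × w ≡ p ++ x ∷ y ∷ x ∷ q × k ≡ suc (length p))
  braidShadow-site []              _             (_ , _ , () , _)
  braidShadow-site (_ ∷ _)         zero          (_ , _ , () , _)
  braidShadow-site (_ ∷ [])        (suc zero)    (_ , _ , _ , () , _)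
  braidShadow-site (_ ∷ _ ∷ [])    (suc zero)    (_ , _ , _ , _ , () , _)
  braidShadow-site (x ∷ y ∷ _ ∷ q) (suc zero)    (_ , _ , refl , refl , refl , mxy) =
    [] , q , x , y , mxy , refl , refl
  braidShadow-site (c ∷ w)         (suc (suc k)) shadow with braidShadow-site w (suc k) shadow
  ... | p , q , x , y , mxy , refl , refl = c ∷ p , q , x , y , mxy , refl , refl

  m≡3⇒≢ : ∀ {x y} → m x y ≡ fin 3 → x ≢ y
  m≡3⇒≢ {x} mxy refl with trans (sym (m-diag x)) mxy
  ... | ()

  ¬reduced-square : ∀ (p q : Word M) a → ¬ Reduced M (p ++ a ∷ a ∷ q)
  ¬reduced-square p q a red = 1+n≰n (≤-trans (n≤1+n _) (+-cancelˡ-≤ (length p) _ _ longer))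
    where
      longer : length p + suc (suc (length q)) ≤ length p + length q
      longer = subst₂ _≤_ (length-++ p) (length-++ p) (red (p ++ q) (cong p q (sym≈ (rel a a 1 (m-diag a)))))

  reduced⇒adjacent-≢ : ∀ {w : Word M} {j a b} → Reduced M w →
    at M w (suc j) ≡ just a → at M w (suc (suc j)) ≡ just b → a ≢ b
  reduced⇒adjacent-≢ {w} {j} red ea eb refl with adjacent-site w j ea eb
  ... | p , q , refl = ¬reduced-square p q _ red

  braidClass-invariant : ∀ {α} (P : Word M → Set) →
    (∀ {w w'} → InBraidClass M α w → BraidMove M w w' → P w ⇔ P w') →
    ∀ {β} → InBraidClass M α β → P α ⇔ P β
  braidClass-invariant {α} P step = along ε
    where
      along : ∀ {w β} → InBraidClass M α w → Star (BraidMove M) w β → P w ⇔ P β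
      along _  ε             = ⇔-id _
      along cw (move ◅ path) = along (cw ◅◅ move ◅ ε) path ⇔-∘ step cw move

  SuppBoth : Word M → ℕ → Fin n → Fin n → Set
  SuppBoth α k x y = Supp M k α x × Supp M k α y

  braidShadow-supp : ∀ {α k} → InBS M α k →
    ∃[ x ] ∃[ y ] (x ≢ y × SuppBoth α k x y × SuppBoth α (suc k) x y × SuppBoth α (suc (suc k)) x y)
  braidShadow-supp (β , cβ , shadow) with braidShadow-site β _ shadow
  ... | p , q , x , y , mxy , refl , refl =
    x , y , m≡3⇒≢ mxy ,
    (inβ 0 refl , inβ' 0 refl) , (inβ' 1 refl , inβ 1 refl) , (inβ 2 refl , inβ' 2 refl)
    where
      inβ : ∀ d {c} → at M (x ∷ y ∷ x ∷ q) (suc d) ≡ just c → Supp M (suc (d + length p)) _ c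
      inβ d e = _ , cβ , trans (at-++ʳ p _ d) e
      inβ' : ∀ d {c} → at M (y ∷ x ∷ y ∷ q) (suc d) ≡ just c → Supp M (suc (d + length p)) _ c
      inβ' d e = _ , cβ ◅◅ braid p q x y mxy ◅ ε , trans (at-++ʳ p _ d) e

  LetterIn : Pred (Fin n) 0ℓ → ℕ → Word M → Set
  LetterIn A k w = Any A (at M w k)

  letterIn-braidMove : ∀ {α} {A : Pred (Fin n) 0ℓ} K → ¬ InBS M α K →
    Supp M K α ⊆ A → Supp M (suc (suc K)) α ⊆ A →
    ∀ {w w'} → InBraidClass M α w → BraidMove M w w' → LetterIn A (suc K) w ⇔ LetterIn A (suc K) w'
  letterIn-braidMove K noShadow ⊆A ⊆A' cw (braid p q x y mxy) with <-or-offset K (length p)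
  ... | inj₁ K<p = Any-cong (at-++ˡ p _ _ K K<p)
  ... | inj₂ (0 , refl) =
    mk⇔ (λ _ → Any-just (at-++ʳ p _ 0) (⊆A' (_ , cw , at-++ʳ p _ 1)))
        (λ _ → Any-just (at-++ʳ p _ 0) (⊆A' (_ , cw ◅◅ braid p q x y mxy ◅ ε , at-++ʳ p _ 1)))
  ... | inj₂ (1 , refl) =
    ⊥-elim (noShadow (_ , cw , x , y , at-++ʳ p _ 0 , at-++ʳ p _ 1 , at-++ʳ p _ 2 , mxy))
  ... | inj₂ (2 , refl) =
    mk⇔ (λ _ → Any-just (at-++ʳ p _ 2) (⊆A (_ , cw , at-++ʳ p _ 1)))
        (λ _ → Any-just (at-++ʳ p _ 2) (⊆A (_ , cw ◅◅ braid p q x y mxy ◅ ε , at-++ʳ p _ 1)))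
  ... | inj₂ (suc (suc (suc d)) , refl) =
    Any-cong (trans (at-++ʳ p _ (3 + d)) (sym (at-++ʳ p _ (3 + d))))

  middleSupp-⊆ : ∀ {α} {A : Pred (Fin n) 0ℓ} K → ¬ InBS M α K →
    Supp M K α ⊆ A → Supp M (suc (suc K)) α ⊆ A →
    ∀ {c} → Supp M (suc K) α c → A c → Supp M (suc K) α ⊆ A
  middleSupp-⊆ {α} {A} K noShadow ⊆A ⊆A' (_ , cβ₀ , e₀) Ac (_ , cβ , e) =
    drop-just (subst (Any A) e (Equivalence.to (invariant cβ) letterIn-α))
    where
      invariant : ∀ {β} → InBraidClass M α β → LetterIn A (suc K) α ⇔ LetterIn A (suc K) β
      invariant = braidClass-invariant (LetterIn A (suc K)) (letterIn-braidMove K noShadow ⊆A ⊆A')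
      letterIn-α : LetterIn A (suc K) α
      letterIn-α = Equivalence.from (invariant cβ₀) (Any-just e₀ Ac)

  path-neighbour-m≡3 : ∀ {s t u a c} → m s t ≡ fin 3 → m t u ≡ fin 3 →
    (a ≡ s ⊎ a ≡ t) → (a ≡ t ⊎ a ≡ u) → (c ≡ s ⊎ c ≡ t ⊎ c ≡ u) → c ≢ a → m a c ≡ fin 3
  path-neighbour-m≡3 mst _   (inj₁ refl) (inj₁ refl) _                  _   = ⊥-elim (m≡3⇒≢ mst refl)
  path-neighbour-m≡3 _   _   (inj₁ refl) (inj₂ refl) (inj₁ refl)        c≢a = ⊥-elim (c≢a refl)
  path-neighbour-m≡3 mst _   (inj₁ refl) (inj₂ refl) (inj₂ (inj₁ refl)) _   = mst
  path-neighbour-m≡3 _   _   (inj₁ refl) (inj₂ refl) (inj₂ (inj₂ refl)) c≢a = ⊥-elim (c≢a refl)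
  path-neighbour-m≡3 mst _   (inj₂ refl) _           (inj₁ refl)        _   = trans (m-sym _ _) mst
  path-neighbour-m≡3 _   _   (inj₂ refl) _           (inj₂ (inj₁ refl)) c≢a = ⊥-elim (c≢a refl)
  path-neighbour-m≡3 _   mtu (inj₂ refl) _           (inj₂ (inj₂ refl)) _   = mtu

  middleSupp : ∀ {α} k {s t u} → InBS M α k → ¬ InBS M α (suc k) → InBS M α (suc (suc k)) →
    (∀ x → Supp M (suc k) α x ⇔ (x ≡ s ⊎ x ≡ t)) →
    (∀ x → Supp M (3 + k) α x ⇔ (x ≡ t ⊎ x ≡ u)) →
    ∀ x → Supp M (2 + k) α x ⇔ (x ≡ s ⊎ x ≡ t ⊎ x ≡ u)
  middleSupp k {s} {t} {u} prev noShadow next hK hK' z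
    with braidShadow-supp prev | braidShadow-supp next
  ... | _ , _ , x≢y , _ , (Kx , Ky) , (Mx , My) | _ , _ , x'≢y' , (Mx' , My') , (Nx' , Ny') , _ =
    mk⇔ (middleSupp-⊆ (suc k) noShadow (st⊆stu ∘ ⇔⇒⊆ hK) (inj₂ ∘ ⇔⇒⊆ hK') Mx (st⊆stu (⇔⇒⊆ hK Kx)))
        λ { (inj₁ refl) → proj₁ Ms×Mt ; (inj₂ (inj₁ refl)) → proj₂ Ms×Mt ; (inj₂ (inj₂ refl)) → proj₂ Mt×Mu }
    where
      st⊆stu : ∀ {z} → z ≡ s ⊎ z ≡ t → z ≡ s ⊎ z ≡ t ⊎ z ≡ u
      st⊆stu = Sum.map₂ inj₁
      Ms×Mt : Supp M (2 + k) _ s × Supp M (2 + k) _ t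
      Ms×Mt = pair-cover x≢y (⇔⇒⊆ hK Kx) (⇔⇒⊆ hK Ky) Mx My
      Mt×Mu : Supp M (2 + k) _ t × Supp M (2 + k) _ u
      Mt×Mu = pair-cover x'≢y' (⇔⇒⊆ hK' Nx') (⇔⇒⊆ hK' Ny') Mx' My'

  middleLetters : ∀ {α} k {s t u} → Reduced M α → ¬ InBS M α (suc k) → 3 + k ≤ length α →
    m s t ≡ fin 3 → m t u ≡ fin 3 →
    Supp M (suc k) α ⊆ (λ x → x ≡ s ⊎ x ≡ t) →
    Supp M (2 + k) α ⊆ (λ x → x ≡ s ⊎ x ≡ t ⊎ x ≡ u) →
    Supp M (3 + k) α ⊆ (λ x → x ≡ t ⊎ x ≡ u) →
    ∃[ a ] ∃[ b ] ∃[ c ]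
      (at M α (suc k) ≡ just a × at M α (2 + k) ≡ just c × at M α (3 + k) ≡ just b ×
       a ≢ b × (c ≡ s ⊎ c ≡ t ⊎ c ≡ u) × c ≢ a × c ≢ b)
  middleLetters {α} k red noShadow fits mst mtu ⊆st ⊆stu ⊆tu
    with at-defined α k (m+n≤o⇒n≤o 2 fits) | at-defined α (suc k) (m+n≤o⇒n≤o 1 fits)
       | at-defined α (suc (suc k)) fits
  ... | a , ea | c , ec | b , eb = a , b , c , ea , ec , eb , a≢b , c∈stu , c≢a , c≢b
    where
      c∈stu : c ≡ _ ⊎ c ≡ _ ⊎ c ≡ _
      c∈stu = ⊆stu (α , ε , ec)
      c≢a : c ≢ a
      c≢a = ≢-sym (reduced⇒adjacent-≢ red ea ec)
      c≢b : c ≢ b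
      c≢b = reduced⇒adjacent-≢ red ec eb
      a≢b : a ≢ b
      a≢b refl = noShadow (α , ε , a , c , ea , ec , eb ,
        path-neighbour-m≡3 mst mtu (⊆st (α , ε , ea)) (⊆tu (α , ε , eb)) c∈stu c≢a)

link-shadow : ∀ {n} {M : CoxeterMatrix n} {α : Word M} {r} →
  (∀ j → InBS M α j ⇔ (Odd j × 1 ≤ j × j + 2 ≤ length α)) → length α ≡ suc (2 * r) →
  ∀ k → suc k ≤ r → InBS M α (suc (2 * k))
link-shadow {α = α} {r} bs⇔ len≡ k k<r = Equivalence.from (bs⇔ _) ((k , refl) , s≤s z≤n , fits)
  where
    open ≤-Reasoning
    fits : suc (2 * k) + 2 ≤ length α
    fits = begin
      suc (2 * k + 2)  ≡⟨ ≡.cong suc (+-comm (2 * k) 2) ⟩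
      suc (2 + 2 * k)  ≡⟨ ≡.cong suc (*-suc 2 k) ⟨
      suc (2 * suc k)  ≤⟨ s≤s (*-monoʳ-≤ 2 k<r) ⟩
      suc (2 * r)      ≡⟨ len≡ ⟨
      length α         ∎

link-no-even-shadow : ∀ {n} {M : CoxeterMatrix n} {α : Word M} →
  (∀ j → InBS M α j ⇔ (Odd j × 1 ≤ j × j + 2 ≤ length α)) → ∀ k → ¬ InBS M α (2 * k)
link-no-even-shadow bs⇔ k = ¬Odd-2* k ∘ proj₁ ∘ ⇔⇒⊆ bs⇔

2*[1+i]+1≡3+2*i : ∀ i → 2 * suc i + 1 ≡ 3 + 2 * i
2*[1+i]+1≡3+2*i i = trans (+-comm _ 1) (≡.cong suc (*-suc 2 i))

2*[1+i]+2≡4+2*i : ∀ i → 2 * suc i + 2 ≡ 4 + 2 * i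
2*[1+i]+2≡4+2*i i = trans (+-comm _ 2) (≡.cong (2 +_) (*-suc 2 i))

lemma5p3 : ∀ {n} (M : CoxeterMatrix n) → SimplyLaced M → TriangleFree M →
    (α : Word M) → IsLink M α → (r : ℕ) → 2 ≤ r → length α ≡ suc (2 * r) →
    (i : ℕ) → 1 ≤ i → i ≤ r ∸ 1 → (s t u : Fin n) →
    (∀ x → Supp M (2 * i) α x ⇔ (x ≡ s ⊎ x ≡ t)) →
    (∀ x → Supp M (2 * i + 2) α x ⇔ (x ≡ t ⊎ x ≡ u)) →
    CoxeterMatrix.m M s t ≡ fin 3 → CoxeterMatrix.m M t u ≡ fin 3 →
    (∀ x → Supp M (2 * i + 1) α x ⇔ (x ≡ s ⊎ x ≡ t ⊎ x ≡ u)) ×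
    (∃[ a ] ∃[ b ] ∃[ c ]
      (at M α (2 * i) ≡ just a × at M α (2 * i + 1) ≡ just c × at M α (2 * i + 2) ≡ just b ×
       a ≢ b × (c ≡ s ⊎ c ≡ t ⊎ c ≡ u) × c ≢ a × c ≢ b))
lemma5p3 M _ _ α (_ , _ , inj₁ len≡1) (suc (suc r)) (s≤s (s≤s z≤n)) len≡ _ _ _ _ _ _ _ _ _ _
  with () ← trans (sym len≡) len≡1
lemma5p3 M _ _ α (red , _ , inj₂ (_ , bs⇔)) (suc (suc r)) _ len≡ (suc i) _ 1+i≤1+r s t u hK hK' mst mtu
  rewrite 2*[1+i]+1≡3+2*i i | 2*[1+i]+2≡4+2*i i | *-suc 2 i
  = supp , middleLetters M k red noShadow fits mst mtu (⇔⇒⊆ hK) (⇔⇒⊆ supp) (⇔⇒⊆ hK')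
  where
    k : ℕ
    k = suc (2 * i)
    prev : InBS M α k
    prev = link-shadow bs⇔ len≡ i (m≤n⇒m≤1+n 1+i≤1+r)
    next : InBS M α (2 + k)
    next = subst (InBS M α) (≡.cong suc (*-suc 2 i)) (link-shadow bs⇔ len≡ (suc i) (s≤s 1+i≤1+r))
    noShadow : ¬ InBS M α (suc k)
    noShadow = link-no-even-shadow bs⇔ (suc i) ∘ subst (InBS M α) (sym (*-suc 2 i))
    supp : ∀ x → Supp M (2 + k) α x ⇔ (x ≡ s ⊎ x ≡ t ⊎ x ≡ u)
    supp = middleSupp M k prev noShadow next hK hK'
    fits : 3 + k ≤ length α
    fits = m+n≤o⇒n≤o 1 (subst (_≤ length α) (+-comm (2 + k) 2) (proj₂ (proj₂ (⇔⇒⊆ bs⇔ next))))
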